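{- There exists a $\Delta$-Query-Scheme of size $O(\Delta^3\log n)$; that is, there is an absolute constant $c$ such that for every set $V$ of $n$ vertices and every integer $2\le\Delta\le n-1$ there exists a $\Delta$-Query-Scheme on $V$ of size at most $c\,\Delta^3\log n$.
   Context: Definition ($\Delta$-Query-Scheme): for a set $V$ of $n$ vertices and an integer $2\le\Delta\le n-1$, a family $\mathcal{Q}=\{Q_1,\dots,Q_\ell\}$ of subsets of $V$ is a $\Delta$-Query-Scheme of size $\ell$ if for every set $\{u,v,w_1,\dots,w_{2\Delta}\}$ of $2\Delta+2$ distinct vertices of $V$ there exists $i$ such that $u,v\in Q_i$ and $\{w_1,\dots,w_{2\Delta}\}\cap Q_i=\varnothing$. -}

module Defs where

open import Data.Nat using (ℕ; _+_; _*_)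
open import Data.Fin using (Fin; zero; suc; _↑ʳ_)
open import Data.Fin.Subset using (Subset; _∈_; _∉_)
open import Data.List using (List)
open import Data.List.Membership.Propositional using () renaming (_∈_ to _∈ₗ_)
open import Data.Product using (∃-syntax; _×_)
open import Function.Definitions using (Injective)
open import Relation.Binary.PropositionalEquality using (_≡_)

-- A family Q = {Q_1,…,Q_ℓ} is a list of subsets; its size is its length.
-- A (2Δ+2)-tuple of distinct vertices is an injective map f : Fin (2 + 2Δ) → Fin n, with
-- u = f 0, v = f 1, w_j = f (2 + j).
IsQueryScheme : (n Δ : ℕ) → List (Subset n) → Set
IsQueryScheme n Δ Q =
  (f : Fin (2 + 2 * Δ) → Fin n) → Injective _≡_ _≡_ f →
  ∃[ S ] (S ∈ₗ Q × f zero ∈ S × f (suc zero) ∈ S ×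
          ((j : Fin (2 * Δ)) → f (2 ↑ʳ j) ∉ S))

-- Colour the vertices with m = 4Δ colours and query the vertices of colour 0.  A fixed tuple
-- (u, v, w₁, …, w₂Δ) is served (u and v coloured 0, no wⱼ coloured 0) by a fraction
-- m⁻² (1 - 1/m)^(2Δ) ≥ 1/(2m²) of all mⁿ colourings, by Bernoulli's inequality.  Derandomise as
-- for set cover: with D = 2m², the colouring serving most of the remaining tuples serves at least
-- a 1/D fraction of them, so D·t greedy choices with 2^t > n^(2Δ+2) serve every tuple, giving
-- 2m²(⌈log₂ n⌉(2Δ + 2) + 1) = O(Δ³ log n) queries.
module Submission where

open import Algebra.Properties.CommutativeSemigroup using (interchange)
open import Data.Bool using (Bool; true; false; not; _∧_; T)
open import Data.Fin using (Fin; zero; suc; _↑ʳ_)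
import Data.Fin.Properties as Fin
open import Data.Fin.Subset using (Subset; _∉_) renaming (_∈_ to _∈ₛ_)
open import Data.List using (List; []; _∷_; _++_; length; map; concatMap; filterᵇ; allFin)
open import Data.List.Extrema.Nat using (argmax; f[xs]≤f[argmax])
open import Data.List.Membership.Propositional using (_∈_; find)
open import Data.List.Membership.Propositional.Properties using (∈-allFin; ∈-concatMap⁺; ∈-map⁺; ∈-filter⁺)
open import Data.List.Properties using (length-map; length-tabulate; map-++; map-∘; map-cong)
open import Data.List.Relation.Unary.All as All using (All; []; _∷_)
open import Data.List.Relation.Unary.All.Properties using (filter⁺) renaming (tabulate⁺ to All-tabulate⁺)
open import Data.List.Relation.Unary.Any as Any using (Any; here; there)
import Data.List.Relation.Unary.Any.Properties as Any
open import Data.Nat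
open import Data.Nat.Induction using (<-wellFounded)
open import Data.Nat.ListAction using (sum; product)
open import Data.Nat.ListAction.Properties using (sum-++)
open import Data.Nat.Logarithm using (⌈log₂_⌉; ⌈log₂⌉-mono-≤)
open import Data.Nat.Logarithm.Core using (⌈log2⌉)
open import Data.Nat.Properties
open import Data.Nat.Tactic.RingSolver using (solve-∀)
open import Data.Product using (∃-syntax; _×_; _,_)
open import Data.Sum using (_⊎_; inj₁; inj₂; [_,_]; map₁)
open import Data.Unit using (tt)
open import Data.Vec using (Vec; []; _∷_; toList; lookup; _[_]≔_)
import Data.Vec as Vec
open import Data.Vec.Properties
  using (lookup-map; lookup∘tabulate; lookup∘update; lookup∘update′; lookup⇒[]=; []=⇒lookup; map-[]≔)
open import Function using (_∘_; id)
open import Induction.WellFounded using (Acc; acc)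
open import Relation.Binary.PropositionalEquality hiding ([_])
open import Relation.Nullary using (yes; no; contradiction)
open import Relation.Nullary.Decidable using (T?)

open import Defs

private variable
  A B : Set
  n : ℕ

indicator : Bool → ℕ
indicator true = 1
indicator false = 0

indicator-∧ : ∀ a b → indicator (a ∧ b) ≡ indicator a * indicator b
indicator-∧ true b = sym (+-identityʳ _)
indicator-∧ false b = refl

count : (A → Bool) → List A → ℕ
count p xs = sum (map (indicator ∘ p) xs)

sum-map-+ : ∀ (f g : A → ℕ) xs →
            sum (map (λ x → f x + g x) xs) ≡ sum (map f xs) + sum (map g xs)
sum-map-+ f g [] = refl
sum-map-+ f g (x ∷ xs) =
  trans (cong (f x + g x +_) (sum-map-+ f g xs)) (interchange +-commutativeSemigroup (f x) (g x) _ _)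

sum-map-*ˡ : ∀ c (f : A → ℕ) xs → sum (map (λ x → c * f x) xs) ≡ c * sum (map f xs)
sum-map-*ˡ c f [] = sym (*-zeroʳ c)
sum-map-*ˡ c f (x ∷ xs) =
  trans (cong (c * f x +_) (sum-map-*ˡ c f xs)) (sym (*-distribˡ-+ c (f x) _))

sum-map-*ʳ : ∀ c (f : A → ℕ) xs → sum (map (λ x → f x * c) xs) ≡ sum (map f xs) * c
sum-map-*ʳ c f [] = refl
sum-map-*ʳ c f (x ∷ xs) =
  trans (cong (f x * c +_) (sum-map-*ʳ c f xs)) (sym (*-distribʳ-+ c (f x) _))

sum-map-swap : ∀ (f : A → B → ℕ) xs ys →
               sum (map (λ x → sum (map (f x) ys)) xs) ≡ sum (map (λ y → sum (map (λ x → f x y) xs)) ys)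
sum-map-swap f [] ys = sym (sum-map-zero ys)
  where
  sum-map-zero : ∀ (ys : List B) → sum (map (λ _ → 0) ys) ≡ 0
  sum-map-zero [] = refl
  sum-map-zero (y ∷ ys) = sum-map-zero ys
sum-map-swap f (x ∷ xs) ys =
  trans (cong (sum (map (f x) ys) +_) (sum-map-swap f xs ys))
        (sym (sum-map-+ (f x) (λ y → sum (map (λ x → f x y) xs)) ys))

sum-map-≤ : ∀ {f : A → ℕ} {c xs} → All (λ x → f x ≤ c) xs → sum (map f xs) ≤ length xs * c
sum-map-≤ [] = z≤n
sum-map-≤ (fx≤c ∷ fxs≤c) = +-mono-≤ fx≤c (sum-map-≤ fxs≤c)

sum-map-≥ : ∀ {f : A → ℕ} {c xs} → All (λ x → c ≤ f x) xs → length xs * c ≤ sum (map f xs)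
sum-map-≥ [] = z≤n
sum-map-≥ (c≤fx ∷ c≤fxs) = +-mono-≤ c≤fx (sum-map-≥ c≤fxs)

sum-map-concatMap : ∀ (f : B → ℕ) (g : A → List B) xs →
                    sum (map f (concatMap g xs)) ≡ sum (map (λ x → sum (map f (g x))) xs)
sum-map-concatMap f g [] = refl
sum-map-concatMap f g (x ∷ xs) = begin
  sum (map f (g x ++ concatMap g xs))
    ≡⟨ cong sum (map-++ f (g x) _) ⟩
  sum (map f (g x) ++ map f (concatMap g xs))
    ≡⟨ sum-++ (map f (g x)) _ ⟩
  sum (map f (g x)) + sum (map f (concatMap g xs))
    ≡⟨ cong (sum (map f (g x)) +_) (sum-map-concatMap f g xs) ⟩
  sum (map f (g x)) + sum (map (λ x → sum (map f (g x))) xs) ∎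
  where open ≡-Reasoning

count-cong : ∀ {p q : A → Bool} → (∀ x → p x ≡ q x) → ∀ xs → count p xs ≡ count q xs
count-cong p≗q [] = refl
count-cong p≗q (x ∷ xs) = cong₂ (λ b n → indicator b + n) (p≗q x) (count-cong p≗q xs)

count-true : ∀ (xs : List A) → count (λ _ → true) xs ≡ length xs
count-true [] = refl
count-true (x ∷ xs) = cong suc (count-true xs)

count-none : ∀ {p : A → Bool} {xs} → All (λ x → p x ≡ false) xs → count p xs ≡ 0
count-none [] = refl
count-none (px≡false ∷ pxs≡false) rewrite px≡false = count-none pxs≡false

count-not+count : ∀ (p : A → Bool) xs → count (not ∘ p) xs + count p xs ≡ length xs
count-not+count p [] = refl
count-not+count p (x ∷ xs) with p x
... | true  = trans (+-suc _ _) (cong suc (count-not+count p xs))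
... | false = cong suc (count-not+count p xs)

count≤length : ∀ (p : A → Bool) xs → count p xs ≤ length xs
count≤length p xs = ≤-trans (m≤n+m (count p xs) _) (≤-reflexive (count-not+count p xs))

length-filterᵇ : ∀ (p : A → Bool) xs → length (filterᵇ p xs) ≡ count p xs
length-filterᵇ p [] = refl
length-filterᵇ p (x ∷ xs) with p x
... | true  = cong suc (length-filterᵇ p xs)
... | false = length-filterᵇ p xs

-- (1 + 1/a)^n ≥ 1 + n/a, with denominators cleared.
bernoulli-≥ : ∀ a n → a ^ n * (a + n) ≤ suc a ^ n * a
bernoulli-≥ a zero = ≤-reflexive (cong (_+ 0) (+-identityʳ a))
bernoulli-≥ a (suc n) = begin
  a * a ^ n * (a + suc n)    ≡⟨ e₁ a (a ^ n) n ⟩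
  a ^ n * (a * (a + suc n))  ≤⟨ *-monoʳ-≤ (a ^ n) (≤-trans (m≤m+n _ n) (≤-reflexive (e₂ a n))) ⟩
  a ^ n * ((a + n) * suc a)  ≡⟨ *-assoc (a ^ n) (a + n) (suc a) ⟨
  a ^ n * (a + n) * suc a    ≤⟨ *-monoˡ-≤ (suc a) (bernoulli-≥ a n) ⟩
  suc a ^ n * a * suc a      ≡⟨ e₃ (suc a ^ n) a ⟩
  suc a * suc a ^ n * a      ∎
  where
  open ≤-Reasoning
  e₁ : ∀ a x n → a * x * (a + suc n) ≡ x * (a * (a + suc n))
  e₁ = solve-∀
  e₂ : ∀ a n → a * (a + suc n) + n ≡ (a + n) * suc a
  e₂ = solve-∀
  e₃ : ∀ x a → x * a * suc a ≡ suc a * x * a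
  e₃ = solve-∀

2*n^[1+n]≤[1+n]^[1+n] : ∀ n .{{_ : NonZero n}} → 2 * n ^ suc n ≤ suc n ^ suc n
2*n^[1+n]≤[1+n]^[1+n] n = *-cancelʳ-≤ _ _ n (begin
  2 * n ^ suc n * n        ≡⟨ e (n ^ suc n) n ⟩
  n ^ suc n * (n + n)      ≤⟨ *-monoʳ-≤ (n ^ suc n) (+-monoʳ-≤ n (n≤1+n n)) ⟩
  n ^ suc n * (n + suc n)  ≤⟨ bernoulli-≥ n (suc n) ⟩
  suc n ^ suc n * n        ∎)
  where
  open ≤-Reasoning
  e : ∀ x n → 2 * x * n ≡ x * (n + n)
  e = solve-∀

-- Bernoulli's inequality (1 - 1/m)^n ≥ 1 - n/m for m = b + 1, with the subtraction moved across.
bernoulli-≤ : ∀ b n → suc b ^ n * suc b ≤ b ^ n * suc b + n * suc b ^ n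
bernoulli-≤ b zero = m≤m+n (1 * suc b) 0
bernoulli-≤ b (suc n) = begin
  suc b * suc b ^ n * suc b                            ≡⟨ *-assoc (suc b) (suc b ^ n) (suc b) ⟩
  suc b * (suc b ^ n * suc b)                          ≤⟨ *-monoʳ-≤ (suc b) (bernoulli-≤ b n) ⟩
  suc b * (b ^ n * suc b + n * suc b ^ n)              ≡⟨ e₁ b (b ^ n) (suc b ^ n) n ⟩
  b * b ^ n * suc b + suc b * b ^ n + n * (suc b * suc b ^ n)
    ≤⟨ +-monoˡ-≤ _ (+-monoʳ-≤ (b * b ^ n * suc b) (*-monoʳ-≤ (suc b) (^-monoˡ-≤ n (n≤1+n b)))) ⟩
  b * b ^ n * suc b + suc b * suc b ^ n + n * (suc b * suc b ^ n)  ≡⟨ +-assoc (b * b ^ n * suc b) _ _ ⟩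
  b * b ^ n * suc b + suc n * (suc b * suc b ^ n)      ∎
  where
  open ≤-Reasoning
  e₁ : ∀ b x y n → suc b * (x * suc b + n * y) ≡ b * x * suc b + suc b * x + n * (suc b * y)
  e₁ = solve-∀

[1+b]^n≤2*b^n : ∀ b n → suc b ≡ 2 * n → suc b ^ n ≤ 2 * b ^ n
[1+b]^n≤2*b^n b n m≡2n =
  *-cancelʳ-≤ (m ^ n) (2 * b ^ n) m (+-cancelʳ-≤ (m ^ n * m) (m ^ n * m) _ (begin
    m ^ n * m + m ^ n * m          ≡⟨ e₁ (m ^ n * m) ⟩
    2 * (m ^ n * m)                ≤⟨ *-monoʳ-≤ 2 (bernoulli-≤ b n) ⟩
    2 * (b ^ n * m + n * m ^ n)    ≡⟨ e₂ (b ^ n) m n (m ^ n) ⟩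
    2 * b ^ n * m + 2 * n * m ^ n  ≡⟨ cong (λ x → 2 * b ^ n * m + x * m ^ n) m≡2n ⟨
    2 * b ^ n * m + m * m ^ n      ≡⟨ cong (2 * b ^ n * m +_) (*-comm m (m ^ n)) ⟩
    2 * b ^ n * m + m ^ n * m      ∎))
  where
  open ≤-Reasoning
  m = suc b
  e₁ : ∀ x → x + x ≡ 2 * x
  e₁ = solve-∀
  e₂ : ∀ x m n y → 2 * (x * m + n * y) ≡ 2 * x * m + 2 * n * y
  e₂ = solve-∀

m*n≤o⇒m^k*n^k≤o^k : ∀ {m n o} k → m * n ≤ o → m ^ k * n ^ k ≤ o ^ k
m*n≤o⇒m^k*n^k≤o^k zero _ = ≤-refl
m*n≤o⇒m^k*n^k≤o^k {m} {n} {o} (suc k) mn≤o = begin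
  m * m ^ k * (n * n ^ k)    ≡⟨ e m (m ^ k) n (n ^ k) ⟩
  m * n * (m ^ k * n ^ k)    ≤⟨ *-mono-≤ mn≤o (m*n≤o⇒m^k*n^k≤o^k k mn≤o) ⟩
  o * o ^ k                  ∎
  where
  open ≤-Reasoning
  e : ∀ a x b y → a * x * (b * y) ≡ a * b * (x * y)
  e = solve-∀

module GreedyCover {A B : Set} (covers : B → A → Bool) (C : List B) (default : B) (k : ℕ)
                   .{{_ : NonZero (length C)}} where

  Dense : A → Set
  Dense a = length C ≤ suc k * count (λ h → covers h a) C

  Covered : List B → A → Set
  Covered H a = Any (λ h → covers h a ≡ true) H

  uncovered : B → List A → List A
  uncovered h = filterᵇ (not ∘ covers h)

  covered-or-uncovered : ∀ h R → All (λ a → covers h a ≡ true ⊎ a ∈ uncovered h R) R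
  covered-or-uncovered h R = All.tabulate split
    where
    split : ∀ {a} → a ∈ R → covers h a ≡ true ⊎ a ∈ uncovered h R
    split {a} a∈R with covers h a in eq
    ... | true  = inj₁ refl
    ... | false = inj₂ (∈-filter⁺ (T? ∘ not ∘ covers h) a∈R (subst (T ∘ not) (sym eq) tt))

  best : List A → B
  best R = argmax (λ h → count (covers h) R) default C

  -- Double counting: the candidates cover R with total multiplicity at least |R| |C| / (k + 1),
  -- and best R attains at least the average.
  best-covers-fraction : ∀ R → All Dense R → length R ≤ suc k * count (covers (best R)) R
  best-covers-fraction R dense = *-cancelʳ-≤ (length R) _ (length C) (begin
    length R * length C
      ≤⟨ sum-map-≥ dense ⟩
    sum (map (λ a → suc k * count (λ h → covers h a) C) R)
      ≡⟨ sum-map-*ˡ (suc k) _ R ⟩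
    suc k * sum (map (λ a → count (λ h → covers h a) C) R)
      ≡⟨ cong (suc k *_) (sum-map-swap (λ a h → indicator (covers h a)) R C) ⟩
    suc k * sum (map (λ h → count (covers h) R) C)
      ≤⟨ *-monoʳ-≤ (suc k) (sum-map-≤ (f[xs]≤f[argmax] default C)) ⟩
    suc k * (length C * count (covers (best R)) R)
      ≡⟨ e (suc k) (length C) _ ⟩
    suc k * count (covers (best R)) R * length C ∎)
    where
    open ≤-Reasoning
    e : ∀ a b c → a * (b * c) ≡ a * c * b
    e = solve-∀

  uncovered-best : ∀ R → All Dense R → suc k * length (uncovered (best R) R) ≤ k * length R
  uncovered-best R dense = +-cancelʳ-≤ (length R) _ _ (begin
    suc k * length U + length R
      ≤⟨ +-monoʳ-≤ (suc k * length U) (best-covers-fraction R dense) ⟩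
    suc k * length U + suc k * covered
      ≡⟨ *-distribˡ-+ (suc k) (length U) covered ⟨
    suc k * (length U + covered)
      ≡⟨ cong (suc k *_) U+covered≡R ⟩
    suc k * length R
      ≡⟨ +-comm (length R) (k * length R) ⟩
    k * length R + length R ∎)
    where
    open ≤-Reasoning
    U = uncovered (best R) R
    covered = count (covers (best R)) R
    U+covered≡R : length U + covered ≡ length R
    U+covered≡R = trans (cong (_+ covered) (length-filterᵇ _ R)) (count-not+count (covers (best R)) R)

  greedy : ∀ j R → All Dense R →
           ∃[ H ] ∃[ R' ] (length H ≡ j × length R' * suc k ^ j ≤ length R * k ^ j ×
                           All (λ a → Covered H a ⊎ a ∈ R') R)
  greedy zero R _ = [] , R , refl , ≤-refl , All.tabulate inj₂
  greedy (suc j) R dense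
    with H , R' , refl , shrink , split ← greedy j (uncovered (best R) R) (filter⁺ _ dense) =
    best R ∷ H , R' , refl , shrink′ , All.map step (covered-or-uncovered (best R) R)
    where
    h = best R
    open ≤-Reasoning
    shrink′ : length R' * (suc k * suc k ^ j) ≤ length R * (k * k ^ j)
    shrink′ = begin
      length R' * (suc k * suc k ^ j)           ≡⟨ e₁ (length R') (suc k) (suc k ^ j) ⟩
      suc k * (length R' * suc k ^ j)           ≤⟨ *-monoʳ-≤ (suc k) shrink ⟩
      suc k * (length (uncovered h R) * k ^ j)  ≡⟨ *-assoc (suc k) (length (uncovered h R)) (k ^ j) ⟨
      suc k * length (uncovered h R) * k ^ j    ≤⟨ *-monoˡ-≤ (k ^ j) (uncovered-best R dense) ⟩
      k * length R * k ^ j                      ≡⟨ e₂ k (length R) (k ^ j) ⟩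
      length R * (k * k ^ j)                    ∎
      where
      e₁ : ∀ a b c → a * (b * c) ≡ b * (a * c)
      e₁ = solve-∀
      e₂ : ∀ a b c → a * b * c ≡ b * (a * c)
      e₂ = solve-∀
    step : ∀ {a} → covers h a ≡ true ⊎ a ∈ uncovered h R → Covered (h ∷ H) a ⊎ a ∈ R'
    step (inj₁ hit) = inj₁ (here hit)
    step (inj₂ a∈U) = map₁ there (All.lookup split a∈U)

  -- (1 - 1/(k + 1))^(k + 1) ≤ 1/2, so every k + 1 greedy rounds halve the uncovered part.
  greedy-cover : ∀ t R .{{_ : NonZero k}} → All Dense R → length R < 2 ^ t →
                 ∃[ H ] (length H ≡ suc k * t × All (Covered H) R)
  greedy-cover t R dense R<2^t with greedy (suc k * t) R dense
  ... | H , [] , len , _ , split = H , len , All.map [ id , (λ ()) ] split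
  ... | H , a ∷ R' , _ , shrink , _ = contradiction (begin-strict
    suc k ^ j                         ≤⟨ m≤m+n (suc k ^ j) _ ⟩
    length (a ∷ R') * suc k ^ j       ≤⟨ shrink ⟩
    length R * k ^ j                  <⟨ *-monoˡ-< (k ^ j) {{m^n≢0 k j}} R<2^t ⟩
    2 ^ t * k ^ j                     ≡⟨ cong (2 ^ t *_) (^-*-assoc k (suc k) t) ⟨
    2 ^ t * (k ^ suc k) ^ t           ≤⟨ m*n≤o⇒m^k*n^k≤o^k t (2*n^[1+n]≤[1+n]^[1+n] k) ⟩
    (suc k ^ suc k) ^ t               ≡⟨ ^-*-assoc (suc k) (suc k) t ⟩
    suc k ^ j                         ∎) (<-irrefl refl)
    where
    open ≤-Reasoning
    j = suc k * t

vectors : List A → ∀ n → List (Vec A n)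
vectors xs zero = [] ∷ []
vectors xs (suc n) = concatMap (λ x → map (x ∷_) (vectors xs n)) xs

∈-vectors : ∀ {xs : List A} → (∀ x → x ∈ xs) → (v : Vec A n) → v ∈ vectors xs n
∈-vectors all∈ [] = here refl
∈-vectors all∈ (x ∷ v) =
  ∈-concatMap⁺ _ (Any.map (λ { refl → ∈-map⁺ (x ∷_) (∈-vectors all∈ v) }) (all∈ x))

satisfies : Vec (A → Bool) n → Vec A n → Bool
satisfies [] [] = true
satisfies (p ∷ ps) (x ∷ xs) = p x ∧ satisfies ps xs

satisfies-lookup : ∀ (ps : Vec (A → Bool) n) v i →
                   satisfies ps v ≡ true → lookup ps i (lookup v i) ≡ true
satisfies-lookup (p ∷ ps) (x ∷ v) i sat with p x in px
satisfies-lookup (p ∷ ps) (x ∷ v) zero    sat | true = px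
satisfies-lookup (p ∷ ps) (x ∷ v) (suc i) sat | true = satisfies-lookup ps v i sat

count-satisfies : ∀ (xs : List A) (ps : Vec (A → Bool) n) →
                  count (satisfies ps) (vectors xs n) ≡ product (toList (Vec.map (λ p → count p xs) ps))
count-satisfies xs [] = refl
count-satisfies {n = suc n} xs (p ∷ ps) = begin
  count (satisfies (p ∷ ps)) (vectors xs (suc n))
    ≡⟨ sum-map-concatMap (indicator ∘ satisfies (p ∷ ps)) (λ x → map (x ∷_) (vectors xs n)) xs ⟩
  sum (map (λ x → count (satisfies (p ∷ ps)) (map (x ∷_) (vectors xs n))) xs)
    ≡⟨ cong sum (map-cong count-∷ xs) ⟩
  sum (map (λ x → indicator (p x) * count (satisfies ps) (vectors xs n)) xs)
    ≡⟨ sum-map-*ʳ _ (indicator ∘ p) xs ⟩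
  count p xs * count (satisfies ps) (vectors xs n)
    ≡⟨ cong (count p xs *_) (count-satisfies xs ps) ⟩
  count p xs * product (toList (Vec.map (λ p → count p xs) ps)) ∎
  where
  open ≡-Reasoning
  count-∷ : ∀ x → count (satisfies (p ∷ ps)) (map (x ∷_) (vectors xs n))
                  ≡ indicator (p x) * count (satisfies ps) (vectors xs n)
  count-∷ x = begin
    sum (map (indicator ∘ satisfies (p ∷ ps)) (map (x ∷_) (vectors xs n)))
      ≡⟨ cong sum (map-∘ (vectors xs n)) ⟨
    sum (map (λ v → indicator (p x ∧ satisfies ps v)) (vectors xs n))
      ≡⟨ cong sum (map-cong (λ v → indicator-∧ (p x) (satisfies ps v)) (vectors xs n)) ⟩
    sum (map (λ v → indicator (p x) * indicator (satisfies ps v)) (vectors xs n))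
      ≡⟨ sum-map-*ˡ (indicator (p x)) _ (vectors xs n) ⟩
    indicator (p x) * count (satisfies ps) (vectors xs n) ∎

count-satisfies-replicate : ∀ (xs : List A) n p →
                            count (satisfies (Vec.replicate n p)) (vectors xs n) ≡ count p xs ^ n
count-satisfies-replicate xs n p = trans (count-satisfies xs (Vec.replicate n p)) (product-replicate n)
  where
  product-replicate : ∀ n →
                      product (toList (Vec.map (λ q → count q xs) (Vec.replicate n p))) ≡ count p xs ^ n
  product-replicate zero = refl
  product-replicate (suc n) = cong (count p xs *_) (product-replicate n)

length-vectors : ∀ (xs : List A) n → length (vectors xs n) ≡ length xs ^ n
length-vectors xs n = begin
  length (vectors xs n)
    ≡⟨ count-true (vectors xs n) ⟨
  count (λ _ → true) (vectors xs n)
    ≡⟨ count-cong (satisfies-true n) (vectors xs n) ⟩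
  count (satisfies (Vec.replicate n (λ _ → true))) (vectors xs n)
    ≡⟨ count-satisfies-replicate xs n (λ _ → true) ⟩
  count (λ _ → true) xs ^ n
    ≡⟨ cong (_^ n) (count-true xs) ⟩
  length xs ^ n ∎
  where
  open ≡-Reasoning
  satisfies-true : ∀ n (v : Vec A n) → true ≡ satisfies (Vec.replicate n (λ _ → true)) v
  satisfies-true zero [] = refl
  satisfies-true (suc n) (x ∷ v) = satisfies-true n v

product-[]≔-≤ : ∀ (ws : Vec ℕ n) i {y c} → lookup ws i ≤ c →
                product (toList ws) * y ≤ product (toList (ws [ i ]≔ y)) * c
product-[]≔-≤ (w ∷ ws) zero {y} {c} w≤c = begin
  w * P * y  ≡⟨ e w P y ⟩
  P * y * w  ≤⟨ *-monoʳ-≤ (P * y) w≤c ⟩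
  P * y * c  ≡⟨ cong (_* c) (*-comm P y) ⟩
  y * P * c  ∎
  where
  open ≤-Reasoning
  P = product (toList ws)
  e : ∀ a b c → a * b * c ≡ b * c * a
  e = solve-∀
product-[]≔-≤ (w ∷ ws) (suc i) {y} {c} wᵢ≤c = begin
  w * product (toList ws) * y                 ≡⟨ *-assoc w _ y ⟩
  w * (product (toList ws) * y)               ≤⟨ *-monoʳ-≤ w (product-[]≔-≤ ws i wᵢ≤c) ⟩
  w * (product (toList (ws [ i ]≔ y)) * c)    ≡⟨ *-assoc w _ c ⟨
  w * product (toList (ws [ i ]≔ y)) * c      ∎
  where open ≤-Reasoning

count-satisfies-[]≔ : ∀ (xs : List A) (ps : Vec (A → Bool) n) i p →
                      count (satisfies ps) (vectors xs n) * count p xs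
                        ≤ count (satisfies (ps [ i ]≔ p)) (vectors xs n) * length xs
count-satisfies-[]≔ {A = A} xs ps i p = begin
  count (satisfies ps) (vectors xs _) * count p xs
    ≡⟨ cong (_* count p xs) (count-satisfies xs ps) ⟩
  product (toList (Vec.map cnt ps)) * count p xs
    ≤⟨ product-[]≔-≤ (Vec.map cnt ps) i cntᵢ≤length ⟩
  product (toList (Vec.map cnt ps [ i ]≔ cnt p)) * length xs
    ≡⟨ cong (λ ws → product (toList ws) * length xs) (map-[]≔ cnt ps i) ⟨
  product (toList (Vec.map cnt (ps [ i ]≔ p))) * length xs
    ≡⟨ cong (_* length xs) (count-satisfies xs (ps [ i ]≔ p)) ⟨
  count (satisfies (ps [ i ]≔ p)) (vectors xs _) * length xs ∎
  where
  open ≤-Reasoning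
  cnt : (A → Bool) → ℕ
  cnt q = count q xs
  cntᵢ≤length : lookup (Vec.map cnt ps) i ≤ length xs
  cntᵢ≤length = ≤-trans (≤-reflexive (lookup-map i cnt ps)) (count≤length (lookup ps i) xs)

assignAll : ∀ {k} → Vec (Fin n) k → A → Vec A n → Vec A n
assignAll [] a v = v
assignAll (i ∷ is) a v = assignAll is a v [ i ]≔ a

lookup-assignAll : ∀ {k} (is : Vec (Fin n) k) (a : A) v j → lookup (assignAll is a v) (lookup is j) ≡ a
lookup-assignAll (i ∷ is) a v zero = lookup∘update i (assignAll is a v) a
lookup-assignAll (i ∷ is) a v (suc j) with lookup is j Fin.≟ i
... | yes refl = lookup∘update i (assignAll is a v) a
... | no  iⱼ≢i = trans (lookup∘update′ iⱼ≢i (assignAll is a v) a) (lookup-assignAll is a v j)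

count-satisfies-assignAll : ∀ {k} (xs : List A) (ps : Vec (A → Bool) n) (is : Vec (Fin n) k) p →
                            count (satisfies ps) (vectors xs n) * count p xs ^ k
                              ≤ count (satisfies (assignAll is p ps)) (vectors xs n) * length xs ^ k
count-satisfies-assignAll xs ps [] p = ≤-refl
count-satisfies-assignAll {A = A} {n = n} {k = suc k} xs ps (i ∷ is) p = begin
  satisfying ps * (c * c ^ k)          ≡⟨ e (satisfying ps) c (c ^ k) ⟩
  satisfying ps * c ^ k * c            ≤⟨ *-monoˡ-≤ c (count-satisfies-assignAll xs ps is p) ⟩
  satisfying W * L ^ k * c             ≡⟨ e′ (satisfying W) (L ^ k) c ⟩
  satisfying W * c * L ^ k             ≤⟨ *-monoˡ-≤ (L ^ k) (count-satisfies-[]≔ xs W i p) ⟩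
  satisfying (W [ i ]≔ p) * L * L ^ k  ≡⟨ *-assoc (satisfying (W [ i ]≔ p)) L (L ^ k) ⟩
  satisfying (W [ i ]≔ p) * (L * L ^ k) ∎
  where
  open ≤-Reasoning
  satisfying : Vec (A → Bool) n → ℕ
  satisfying qs = count (satisfies qs) (vectors xs n)
  c = count p xs
  L = length xs
  W = assignAll is p ps
  e : ∀ a b d → a * (b * d) ≡ a * d * b
  e = solve-∀
  e′ : ∀ a b d → a * b * d ≡ a * d * b
  e′ = solve-∀

n≤2^⌈log₂n⌉ : ∀ n → n ≤ 2 ^ ⌈log₂ n ⌉
n≤2^⌈log₂n⌉ n = n≤2^⌈log2⌉n n (<-wellFounded n)
  where
  n≤2^⌈log2⌉n : ∀ n (rec : Acc _<_ n) → n ≤ 2 ^ ⌈log2⌉ n rec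
  n≤2^⌈log2⌉n zero _ = z≤n
  n≤2^⌈log2⌉n (suc zero) _ = s≤s z≤n
  n≤2^⌈log2⌉n (suc (suc n)) (acc rs) = begin
    2 + n                     ≤⟨ +-monoʳ-≤ 2 n≤⌈n/2⌉+⌈n/2⌉ ⟩
    2 + (⌈ n /2⌉ + ⌈ n /2⌉)   ≡⟨ e ⌈ n /2⌉ ⟩
    2 * suc ⌈ n /2⌉           ≤⟨ *-monoʳ-≤ 2 (n≤2^⌈log2⌉n (suc ⌈ n /2⌉) _) ⟩
    2 * 2 ^ ⌈log2⌉ (suc ⌈ n /2⌉) _ ∎
    where
    open ≤-Reasoning
    n≤⌈n/2⌉+⌈n/2⌉ : n ≤ ⌈ n /2⌉ + ⌈ n /2⌉
    n≤⌈n/2⌉+⌈n/2⌉ = subst (_≤ ⌈ n /2⌉ + ⌈ n /2⌉) (⌊n/2⌋+⌈n/2⌉≡n n) (+-monoˡ-≤ ⌈ n /2⌉ (⌊n/2⌋≤⌈n/2⌉ n))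
    e : ∀ x → 2 + (x + x) ≡ 2 * suc x
    e = solve-∀

isZero : Fin n → Bool
isZero zero = true
isZero (suc _) = false

count-isZero : ∀ b → count isZero (allFin (suc b)) ≡ 1
count-isZero b = cong suc (count-none {p = isZero} (All-tabulate⁺ {n = b} {f = suc} (λ _ → refl)))

count-nonZero : ∀ b → count (not ∘ isZero) (allFin (suc b)) ≡ b
count-nonZero b = suc-injective (begin
  suc (count (not ∘ isZero) (allFin (suc b)))
    ≡⟨ +-comm 1 _ ⟩
  count (not ∘ isZero) (allFin (suc b)) + 1
    ≡⟨ cong (count (not ∘ isZero) (allFin (suc b)) +_) (count-isZero b) ⟨
  count (not ∘ isZero) (allFin (suc b)) + count isZero (allFin (suc b))
    ≡⟨ count-not+count isZero (allFin (suc b)) ⟩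
  length (allFin (suc b))
    ≡⟨ length-tabulate id ⟩
  suc b ∎)
  where open ≡-Reasoning

zeroSet : ∀ {m} → Vec (Fin m) n → Subset n
zeroSet = Vec.map isZero

∈-zeroSet : ∀ {m} (h : Vec (Fin m) n) x → isZero (lookup h x) ≡ true → x ∈ₛ zeroSet h
∈-zeroSet h x isZero≡true = lookup⇒[]= x (zeroSet h) (trans (lookup-map x isZero h) isZero≡true)

∉-zeroSet : ∀ {m} (h : Vec (Fin m) n) x → not (isZero (lookup h x)) ≡ true → x ∉ zeroSet h
∉-zeroSet h x nonZero x∈
  with subst (λ b → not b ≡ true) (trans (sym (lookup-map x isZero h)) ([]=⇒lookup x∈)) nonZero
... | ()

module QueryScheme (n Δ b : ℕ) (1+b≡2d : suc b ≡ 2 * (2 * Δ)) where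

  d : ℕ
  d = 2 * Δ

  m : ℕ
  m = suc b

  nonZeroAt : Vec (Fin n) d → Vec (Fin m → Bool) n
  nonZeroAt ws = assignAll ws (not ∘ isZero) (Vec.replicate n (λ _ → true))

  -- For distinct vertices these say h u = h v = 0 ≠ h wⱼ.  With repeated vertices later
  -- assignments override earlier ones; `dense` holds regardless, so every tuple can be kept.
  constraints : Vec (Fin n) (2 + d) → Vec (Fin m → Bool) n
  constraints (u ∷ v ∷ ws) = nonZeroAt ws [ u ]≔ isZero [ v ]≔ isZero

  covers : Vec (Fin m) n → Vec (Fin n) (2 + d) → Bool
  covers h g = satisfies (constraints g) h

  colourings : List (Vec (Fin m) n)
  colourings = vectors (allFin m) n

  length-allFin : length (allFin m) ≡ m
  length-allFin = length-tabulate id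

  length-colourings : length colourings ≡ m ^ n
  length-colourings = trans (length-vectors (allFin m) n) (cong (_^ n) length-allFin)

  satisfying : Vec (Fin m → Bool) n → ℕ
  satisfying ps = count (satisfies ps) colourings

  satisfying-[]≔-isZero : ∀ ps i → satisfying ps ≤ satisfying (ps [ i ]≔ isZero) * m
  satisfying-[]≔-isZero ps i = begin
    satisfying ps
      ≡⟨ *-identityʳ (satisfying ps) ⟨
    satisfying ps * 1
      ≡⟨ cong (satisfying ps *_) (count-isZero b) ⟨
    satisfying ps * count isZero (allFin m)
      ≤⟨ count-satisfies-[]≔ (allFin m) ps i isZero ⟩
    satisfying (ps [ i ]≔ isZero) * length (allFin m)
      ≡⟨ cong (satisfying (ps [ i ]≔ isZero) *_) length-allFin ⟩
    satisfying (ps [ i ]≔ isZero) * m ∎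
    where open ≤-Reasoning

  satisfying-nonZeroAt : ∀ ws → m ^ n * b ^ d ≤ satisfying (nonZeroAt ws) * m ^ d
  satisfying-nonZeroAt ws = begin
    m ^ n * b ^ d
      ≡⟨ cong₂ (λ x y → x * y ^ d) satisfying-replicate (count-nonZero b) ⟨
    satisfying (Vec.replicate n (λ _ → true)) * count (not ∘ isZero) (allFin m) ^ d
      ≤⟨ count-satisfies-assignAll {k = d} (allFin m) (Vec.replicate n (λ _ → true)) ws (not ∘ isZero) ⟩
    satisfying (nonZeroAt ws) * length (allFin m) ^ d
      ≡⟨ cong (λ x → satisfying (nonZeroAt ws) * x ^ d) length-allFin ⟩
    satisfying (nonZeroAt ws) * m ^ d ∎
    where
    open ≤-Reasoning
    satisfying-replicate : satisfying (Vec.replicate n (λ _ → true)) ≡ m ^ n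
    satisfying-replicate = trans (count-satisfies-replicate (allFin m) n (λ _ → true))
                                 (cong (_^ n) (trans (count-true (allFin m)) length-allFin))

  count-covers : ∀ g → m ^ n * b ^ d ≤ count (λ h → covers h g) colourings * m * m * m ^ d
  count-covers (u ∷ v ∷ ws) = ≤-trans (satisfying-nonZeroAt ws) (*-monoˡ-≤ (m ^ d)
    (≤-trans (satisfying-[]≔-isZero W u) (*-monoˡ-≤ m (satisfying-[]≔-isZero (W [ u ]≔ isZero) v))))
    where W = nonZeroAt ws

  dense : ∀ g → length colourings ≤ 2 * m * m * count (λ h → covers h g) colourings
  dense g = subst (_≤ 2 * m * m * c) (sym length-colourings)
    (*-cancelʳ-≤ (m ^ n) (2 * m * m * c) (m ^ d) {{m^n≢0 m d}} (begin
      m ^ n * m ^ d            ≤⟨ *-monoʳ-≤ (m ^ n) ([1+b]^n≤2*b^n b d 1+b≡2d) ⟩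
      m ^ n * (2 * b ^ d)      ≡⟨ e₁ (m ^ n) (b ^ d) ⟩
      2 * (m ^ n * b ^ d)      ≤⟨ *-monoʳ-≤ 2 (count-covers g) ⟩
      2 * (c * m * m * m ^ d)  ≡⟨ e₂ c m (m ^ d) ⟩
      2 * m * m * c * m ^ d    ∎))
    where
    open ≤-Reasoning
    c = count (λ h → covers h g) colourings
    e₁ : ∀ x y → x * (2 * y) ≡ 2 * (x * y)
    e₁ = solve-∀
    e₂ : ∀ c m x → 2 * (c * m * m * x) ≡ 2 * m * m * c * x
    e₂ = solve-∀

  -- suc k is definitionally 2 * m * m, which reduces to a successor.
  k : ℕ
  k = pred (2 * m * m)

  instance
    colourings-nonEmpty : NonZero (length colourings)
    colourings-nonEmpty = subst NonZero (sym length-colourings) (m^n≢0 m n)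

    k-nonZero : NonZero k
    k-nonZero = >-nonZero (pred-mono-≤ (*-mono-≤ (*-monoʳ-≤ 2 (s≤s (z≤n {b}))) (s≤s (z≤n {b}))))

  open GreedyCover covers colourings (Vec.replicate n zero) k

  tuples : List (Vec (Fin n) (2 + d))
  tuples = vectors (allFin n) (2 + d)

  length-tuples : length tuples < 2 ^ suc (⌈log₂ n ⌉ * (2 + d))
  length-tuples = begin-strict
    length tuples                    ≡⟨ length-vectors (allFin n) (2 + d) ⟩
    length (allFin n) ^ (2 + d)      ≡⟨ cong (_^ (2 + d)) (length-tabulate {n = n} id) ⟩
    n ^ (2 + d)                      ≤⟨ ^-monoˡ-≤ (2 + d) (n≤2^⌈log₂n⌉ n) ⟩
    (2 ^ L) ^ (2 + d)                ≡⟨ ^-*-assoc 2 L (2 + d) ⟩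
    2 ^ (L * (2 + d))                <⟨ m<m+n (2 ^ (L * (2 + d))) (m^n>0 2 (L * (2 + d))) ⟩
    2 ^ (L * (2 + d)) + 2 ^ (L * (2 + d))
                                     ≡⟨ cong (2 ^ (L * (2 + d)) +_) (+-identityʳ _) ⟨
    2 ^ suc (L * (2 + d))            ∎
    where
    open ≤-Reasoning
    L = ⌈log₂ n ⌉

  zeroSet-sound : ∀ {u v} ws h → u ≢ v → (∀ j → lookup ws j ≢ u) → (∀ j → lookup ws j ≢ v) →
                  covers h (u ∷ v ∷ ws) ≡ true →
                  u ∈ₛ zeroSet h × v ∈ₛ zeroSet h × (∀ j → lookup ws j ∉ zeroSet h)
  zeroSet-sound {u} {v} ws h u≢v wⱼ≢u wⱼ≢v covered =
    ∈-zeroSet h u (at u (trans (lookup∘update′ u≢v U isZero) (lookup∘update u W isZero))) ,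
    ∈-zeroSet h v (at v (lookup∘update v U isZero)) ,
    λ j → ∉-zeroSet h (lookup ws j) (at (lookup ws j)
      (trans (lookup∘update′ (wⱼ≢v j) U isZero)
      (trans (lookup∘update′ (wⱼ≢u j) W isZero) (lookup-assignAll ws _ _ j))))
    where
    W = nonZeroAt ws
    U = W [ u ]≔ isZero
    at : ∀ x {p} → lookup (constraints (u ∷ v ∷ ws)) x ≡ p → p (lookup h x) ≡ true
    at x eq = subst (λ p → p (lookup h x) ≡ true) eq
                    (satisfies-lookup (constraints (u ∷ v ∷ ws)) h x covered)

  zeroSets-scheme : ∀ H → All (Covered H) tuples → IsQueryScheme n Δ (map zeroSet H)
  zeroSets-scheme H all-covered f f-inj =
    find (Any.map⁺ (Any.map sound (All.lookup all-covered (∈-vectors ∈-allFin g))))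
    where
    ws = Vec.tabulate (λ j → f (2 ↑ʳ j))
    g = f zero ∷ f (suc zero) ∷ ws
    wⱼ≡ : ∀ j → lookup ws j ≡ f (2 ↑ʳ j)
    wⱼ≡ = lookup∘tabulate (λ j → f (2 ↑ʳ j))
    sound : ∀ {h} → covers h g ≡ true →
            f zero ∈ₛ zeroSet h × f (suc zero) ∈ₛ zeroSet h × ((j : Fin d) → f (2 ↑ʳ j) ∉ zeroSet h)
    sound {h} covered with zeroSet-sound ws h (λ eq → contradiction (f-inj eq) λ ())
                             (λ j eq → contradiction (f-inj (trans (sym (wⱼ≡ j)) eq)) λ ())
                             (λ j eq → contradiction (f-inj (trans (sym (wⱼ≡ j)) eq)) λ ()) covered
    ... | u∈ , v∈ , wⱼ∉ = u∈ , v∈ , λ j → subst (_∉ zeroSet h) (wⱼ≡ j) (wⱼ∉ j)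

  query-scheme : ∃[ Q ] (IsQueryScheme n Δ Q × length Q ≡ 2 * m * m * suc (⌈log₂ n ⌉ * (2 + d)))
  query-scheme
    with H , |H| , all-covered ←
         greedy-cover (suc (⌈log₂ n ⌉ * (2 + d))) tuples (All.tabulate (λ {g} _ → dense g)) length-tuples
    = map zeroSet H , zeroSets-scheme H all-covered , trans (length-map zeroSet H) |H|

query-scheme-size : ∀ δ L → 1 ≤ L →
  2 * (8 + 4 * δ) * (8 + 4 * δ) * suc (L * (2 + 2 * (2 + δ))) ≤ 128 * ((2 + δ) ^ 3 * L)
query-scheme-size δ (suc l) _ = begin
  2 * m * m * S               ≤⟨ *-monoʳ-≤ (2 * m * m) (m≤m+n S slack) ⟩
  2 * m * m * (S + slack)     ≡⟨ e δ l ⟩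
  128 * ((2 + δ) ^ 3 * suc l) ∎
  where
  open ≤-Reasoning
  m = 8 + 4 * δ
  S = suc (suc l * (2 + 2 * (2 + δ)))
  slack = 1 + 2 * l + 2 * δ + 2 * δ * l
  e : ∀ δ l → 2 * (8 + 4 * δ) * (8 + 4 * δ) * (suc (suc l * (2 + 2 * (2 + δ))) + (1 + 2 * l + 2 * δ + 2 * δ * l))
              ≡ 128 * ((2 + δ) * ((2 + δ) * ((2 + δ) * 1)) * suc l)
  e = solve-∀

lemma4 : ∃[ c ] ((n Δ : ℕ) → 2 ≤ Δ → Δ ≤ n ∸ 1 →
           ∃[ Q ] (IsQueryScheme n Δ Q × length Q ≤ c * (Δ ^ 3 * ⌈log₂ n ⌉)))
lemma4 = 128 , scheme
  where
  scheme : (n Δ : ℕ) → 2 ≤ Δ → Δ ≤ n ∸ 1 →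
           ∃[ Q ] (IsQueryScheme n Δ Q × length Q ≤ 128 * (Δ ^ 3 * ⌈log₂ n ⌉))
  scheme n (suc (suc δ)) (s≤s (s≤s z≤n)) Δ≤n∸1 =
    bounded (QueryScheme.query-scheme n (2 + δ) (7 + 4 * δ) (1+b≡2d δ))
    where
    1+b≡2d : ∀ δ → 8 + 4 * δ ≡ 2 * (2 * (2 + δ))
    1+b≡2d = solve-∀
    1≤⌈log₂n⌉ : 1 ≤ ⌈log₂ n ⌉
    1≤⌈log₂n⌉ = ⌈log₂⌉-mono-≤ (≤-trans (s≤s (s≤s z≤n)) (≤-trans Δ≤n∸1 (m∸n≤m n 1)))
    bounded : ∃[ Q ] (IsQueryScheme n (2 + δ) Q ×
                      length Q ≡ 2 * (8 + 4 * δ) * (8 + 4 * δ) * suc (⌈log₂ n ⌉ * (2 + 2 * (2 + δ)))) →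
              ∃[ Q ] (IsQueryScheme n (2 + δ) Q × length Q ≤ 128 * ((2 + δ) ^ 3 * ⌈log₂ n ⌉))
    bounded (Q , isScheme , |Q|) =
      Q , isScheme , ≤-trans (≤-reflexive |Q|) (query-scheme-size δ ⌈log₂ n ⌉ 1≤⌈log₂n⌉)
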